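{- For every dialogue tree $d\in\mathcal{D}_{\mathbb N}\mathbb{N}$ and every sequence $\alpha:\mathbb{N}\to\mathbb{N}$, the number $\mathsf{modulus}\,d\,\alpha$ is a modulus of continuity of $\mathsf{dialogue}\,d:(\mathbb{N}\to\mathbb{N})\to\mathbb{N}$ at $\alpha$: for every $\beta:\mathbb{N}\to\mathbb{N}$, if $\alpha(i)=\beta(i)$ for all $i<\mathsf{modulus}\,d\,\alpha$, then $\mathsf{dialogue}\,d\,\alpha=\mathsf{dialogue}\,d\,\beta$.
   Context: Dialogue trees $\mathcal{D}_{\mathbb N}\mathbb{N}$: inductive type with constructors $\eta\,n$ ($n\in\mathbb{N}$) and $\beta\,\varphi\,i$ ($\varphi:\mathbb{N}\to\mathcal{D}_{\mathbb N}\mathbb{N}$, $i\in\mathbb{N}$). $\mathsf{dialogue}(\eta\,x)\,\alpha=x$, $\mathsf{dialogue}(\beta\,\varphi\,i)\,\alpha=\mathsf{dialogue}(\varphi(\alpha\,i))\,\alpha$. $\mathsf{maxQ}(\eta\,n)\,\alpha=0$, $\mathsf{maxQ}(\beta\,\varphi\,n)\,\alpha=\max(n,\mathsf{maxQ}(\varphi(\alpha\,n))\,\alpha)$. $\mathsf{modulus}\,d\,\alpha:=\mathsf{maxQ}\,d\,\alpha+1$. The metatheory is constructive type theory. -}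

module Defs where

open import Data.Nat using (ℕ; zero; suc; _⊔_)

data D : Set where
  η : ℕ → D
  β : (ℕ → D) → ℕ → D

dialogue : D → (ℕ → ℕ) → ℕ
dialogue (η x) α = x
dialogue (β φ i) α = dialogue (φ (α i)) α

maxQ : D → (ℕ → ℕ) → ℕ
maxQ (η n) α = 0
maxQ (β φ n) α = n ⊔ maxQ (φ (α n)) α

modulus : D → (ℕ → ℕ) → ℕ
modulus d α = suc (maxQ d α)

module Submission where

open import Defs
open import Data.Nat using (ℕ; _<_; _≤_; s≤s)
open import Data.Nat.Properties using (m≤m⊔n; m≤n⊔m; ≤-trans)
open import Relation.Binary.PropositionalEquality using (_≡_; refl; cong; module ≡-Reasoning)

_≐_upTo_ : (ℕ → ℕ) → (ℕ → ℕ) → ℕ → Set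
α ≐ γ upTo m = (i : ℕ) → i ≤ m → α i ≡ γ i

dialogue-agrees-upTo-maxQ : (d : D) (α γ : ℕ → ℕ) →
  α ≐ γ upTo maxQ d α → dialogue d α ≡ dialogue d γ
dialogue-agrees-upTo-maxQ (η x) α γ agree = refl
dialogue-agrees-upTo-maxQ (β φ n) α γ agree = begin
  dialogue (φ (α n)) α  ≡⟨ dialogue-agrees-upTo-maxQ (φ (α n)) α γ agree-subtree ⟩
  dialogue (φ (α n)) γ  ≡⟨ cong (λ k → dialogue (φ k) γ) (agree n (m≤m⊔n n _)) ⟩
  dialogue (φ (γ n)) γ  ∎
  where
  open ≡-Reasoning
  agree-subtree : α ≐ γ upTo maxQ (φ (α n)) α
  agree-subtree i i≤ = agree i (≤-trans i≤ (m≤n⊔m n _))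

lemma43 : (d : D) (α β : ℕ → ℕ) →
    ((i : ℕ) → i < modulus d α → α i ≡ β i) →
    dialogue d α ≡ dialogue d β
lemma43 d α γ agree =
  dialogue-agrees-upTo-maxQ d α γ (λ i i≤ → agree i (s≤s i≤))
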